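{- Let $q=2^m$ with $m>1$ odd and let $\tau=2^{(m+1)/2}$. Then there exists $c\in\mathbb F_q^*$ such that $\mathrm{Tr}_{q/2}(c^{\tau+2}+c+1)=0$.
   Context: $\mathrm{Tr}_{q/2}(x)=x+x^2+\cdots+x^{2^{m-1}}$ is the absolute trace from $\mathbb F_q$ to $\mathbb F_2$. -}

module Defs where

open import Level using (Level; suc; _⊔_)
open import Data.Nat using (ℕ; zero; suc; _^_)
open import Data.Fin using (Fin)
open import Data.Product using (Σ; ∃)
open import Relation.Binary.PropositionalEquality using (_≡_; _≢_)
open import Relation.Nullary using (¬_)
open import Algebra.Structures using (IsCommutativeRing)
open import Function.Bundles using (_↔_)

-- Every field of order 2^m is isomorphic to F_{2^m}, so quantifying over
-- all such records is the same as speaking about F_q.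
record FiniteField (c : Level) (n : ℕ) : Set (Level.suc c) where
  infixl 6 _+_
  infixl 7 _*_
  field
    Carrier : Set c
    _+_ _*_ : Carrier → Carrier → Carrier
    -_      : Carrier → Carrier
    0# 1#   : Carrier
    isCommutativeRing : IsCommutativeRing _≡_ _+_ _*_ -_ 0# 1#
    1≢0     : 1# ≢ 0#
    inverse : ∀ x → x ≢ 0# → ∃ λ y → x * y ≡ 1#
    card    : Carrier ↔ Fin n

  pow : Carrier → ℕ → Carrier
  pow x zero    = 1#
  pow x (suc k) = x * pow x k

  sumTo : ℕ → (ℕ → Carrier) → Carrier
  sumTo zero    f = 0#
  sumTo (suc k) f = sumTo k f + f k

  Tr : ℕ → Carrier → Carrier
  Tr m x = sumTo m (λ i → pow x (2 ^ i))

{-# OPTIONS --safe #-}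
-- Write m = 2j + 1, τ = 2^(j+1) and φ(x) = Tr(x^(τ+2) + x). As Tr(1) = m·1 = 1, it suffices
-- to find x with φ(x) = 1 (then x ≠ 0 since φ(0) = 0). The trace is additive, F_2-valued and
-- invariant under Frobenius, which has order m; hence φ is a quadratic form whose polarization
-- is B(x,y) = Tr(x^τ (y^2 + y)). For y ∉ F_2 and x with x^τ = (y^2 + y)⁻¹ we get B(x,y) = 1,
-- so φ(x + y) = φ(x) + φ(y) + 1 and one of φ(x), φ(y), φ(x + y) is 1. The needed facts about
-- F_q (characteristic 2, x^q = x) follow by counting: y ↦ 1 + y and y ↦ x y permute the field.
module Submission where

open import Defs
open import Level using (Level)
open import Data.Nat using (ℕ; _+_; _^_; _<_; _%_; _/_)
open import Data.Product using (∃; _×_)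
open import Relation.Binary.PropositionalEquality using (_≡_; _≢_)

import Data.Nat as ℕ
import Data.Nat.Properties as ℕ
open import Data.Nat.DivMod using (m≡m%n+[m/n]*n; m*n/n≡m)
open import Data.Nat using (zero; suc; s≤s)
open import Data.Fin using (Fin; zero; suc; punchIn)
open import Data.Fin.Properties using (punchInᵢ≢i)
open import Data.Product using (_,_; proj₁; proj₂)
open import Data.Sum using (_⊎_; inj₁; inj₂)
open import Function using (_∘_; Inverse; _↔_; mk↔ₛ′)
open import Function.Construct.Composition using (_↔-∘_)
open import Function.Construct.Symmetry using (↔-sym)
open import Relation.Binary.PropositionalEquality
  using (refl; sym; trans; cong; cong₂; subst; module ≡-Reasoning)
open import Algebra.Bundles using (CommutativeMonoid; CommutativeRing)
open import Relation.Nullary using (Dec; yes; no)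
open import Data.Empty using (⊥-elim)

fresh : ∀ {n} → 2 < n → (i j : Fin n) → ∃ λ k → k ≢ i × k ≢ j
fresh (s≤s (s≤s (s≤s _))) zero          zero          = suc zero , (λ ()) , (λ ())
fresh (s≤s (s≤s (s≤s _))) zero          (suc zero)    = suc (suc zero) , (λ ()) , (λ ())
fresh (s≤s (s≤s (s≤s _))) zero          (suc (suc _)) = suc zero , (λ ()) , (λ ())
fresh (s≤s (s≤s (s≤s _))) (suc zero)    zero          = suc (suc zero) , (λ ()) , (λ ())
fresh (s≤s (s≤s (s≤s _))) (suc zero)    (suc _)       = zero , (λ ()) , (λ ())
fresh (s≤s (s≤s (s≤s _))) (suc (suc _)) zero          = suc zero , (λ ()) , (λ ())
fresh (s≤s (s≤s (s≤s _))) (suc (suc _)) (suc _)       = zero , (λ ()) , (λ ())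

odd⇒≡suc[m/2*2] : ∀ m → m % 2 ≡ 1 → m ≡ suc (m / 2 ℕ.* 2)
odd⇒≡suc[m/2*2] m m%2≡1 = trans (m≡m%n+[m/n]*n m 2) (cong (_+ m / 2 ℕ.* 2) m%2≡1)

odd⇒≡m/2+suc[m/2] : ∀ m → m % 2 ≡ 1 → m ≡ m / 2 + suc (m / 2)
odd⇒≡m/2+suc[m/2] m m%2≡1 = begin
  m                       ≡⟨ odd⇒≡suc[m/2*2] m m%2≡1 ⟩
  suc (j ℕ.* 2)           ≡⟨ cong suc (trans (ℕ.*-comm j 2) (cong (j +_) (ℕ.+-identityʳ j))) ⟩
  suc (j + j)             ≡⟨ sym (ℕ.+-suc j j) ⟩
  j + suc j               ∎
  where
  open ≡-Reasoning
  j : ℕ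
  j = m / 2

odd⇒[m+1]/2≡suc[m/2] : ∀ m → m % 2 ≡ 1 → (m + 1) / 2 ≡ suc (m / 2)
odd⇒[m+1]/2≡suc[m/2] m m%2≡1 = begin
  (m + 1) / 2                   ≡⟨ cong (λ k → (k + 1) / 2) (odd⇒≡suc[m/2*2] m m%2≡1) ⟩
  (suc (j ℕ.* 2) + 1) / 2       ≡⟨ cong (λ k → suc k / 2) (ℕ.+-comm (j ℕ.* 2) 1) ⟩
  suc j ℕ.* 2 / 2               ≡⟨ m*n/n≡m (suc j) 2 ⟩
  suc j                         ∎
  where
  open ≡-Reasoning
  j : ℕ
  j = m / 2

module IndexedSum {a b ℓ} {A : Set a} {n : ℕ} (card : A ↔ Fin n) (M : CommutativeMonoid b ℓ) where
  open CommutativeMonoid M using (Carrier; _≈_; _∙_; ∙-cong; ∙-congˡ; assoc; setoid)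
  module M = CommutativeMonoid M
  open import Algebra.Properties.CommutativeMonoid.Sum M
    using (sum; sum-cong-≗; sum-remove; sum-permute)
  open import Relation.Binary.Reasoning.Setoid setoid
  open Inverse card using (to; from; strictlyInverseˡ; strictlyInverseʳ)

  ∑ : (A → Carrier) → Carrier
  ∑ h = sum (h ∘ from)

  ∑-reindex : (σ : A ↔ A) (h : A → Carrier) → ∑ h ≈ ∑ (h ∘ Inverse.to σ)
  ∑-reindex σ h = begin
    sum (h ∘ from)                                ≈⟨ sum-permute (h ∘ from) (card ↔-∘ (σ ↔-∘ ↔-sym card)) ⟩
    sum (h ∘ from ∘ to ∘ Inverse.to σ ∘ from)     ≡⟨ sum-cong-≗ (λ i → cong h (strictlyInverseʳ (Inverse.to σ (from i)))) ⟩
    sum (h ∘ Inverse.to σ ∘ from)                 ∎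

  sum-update : ∀ {k} (f g : Fin k → Carrier) (i : Fin k) (u : Carrier) →
               f i ≈ u ∙ g i → (∀ j → j ≢ i → f j ≡ g j) → sum f ≈ u ∙ sum g
  sum-update {suc k} f g i u fᵢ f≡g = begin
    sum f                                       ≈⟨ sum-remove {i = i} f ⟩
    f i ∙ sum (f ∘ punchIn i)                   ≈⟨ ∙-cong fᵢ (M.reflexive (sum-cong-≗ (λ j → f≡g _ (punchInᵢ≢i i j)))) ⟩
    (u ∙ g i) ∙ sum (g ∘ punchIn i)             ≈⟨ assoc u (g i) _ ⟩
    u ∙ (g i ∙ sum (g ∘ punchIn i))             ≈⟨ ∙-congˡ (M.sym (sum-remove {i = i} g)) ⟩
    u ∙ sum g                                   ∎

  ∑-update : (f g : A → Carrier) (x : A) (u : Carrier) →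
             f x ≈ u ∙ g x → (∀ y → y ≢ x → f y ≡ g y) → ∑ f ≈ u ∙ ∑ g
  ∑-update f g x u fₓ f≡g = sum-update (f ∘ from) (g ∘ from) (to x) u
    (M.trans (M.reflexive (cong f (strictlyInverseʳ x)))
      (M.trans fₓ (∙-congˡ (M.reflexive (cong g (sym (strictlyInverseʳ x)))))))
    (λ j j≢ → f≡g (from j) (λ e → j≢ (trans (sym (strictlyInverseˡ j)) (cong to e))))

module FiniteFieldProperties {c} {n : ℕ} (F : FiniteField c n) where
  open FiniteField F renaming (_+_ to _⊕_)
  open import Algebra.Structures using (IsCommutativeRing)
  open IsCommutativeRing isCommutativeRing
    using (+-assoc; +-identityˡ; -‿inverseˡ; -‿inverseʳ; *-assoc; *-comm; *-identityˡ; *-identityʳ; zeroˡ; zeroʳ)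
  open ≡-Reasoning

  ring : CommutativeRing c c
  ring = record { isCommutativeRing = isCommutativeRing }

  open CommutativeRing ring using (+-commutativeMonoid; *-commutativeMonoid; commutativeSemiring)
  open import Algebra.Properties.Ring (CommutativeRing.ring ring) using (+-identityˡ-unique)
  open import Algebra.Properties.CommutativeSemiring.Exp commutativeSemiring
    using (^-homo-*; ^-assocʳ; ^-distrib-*) renaming (_^_ to _^ᶠ_)
  open Inverse card using (to; from; strictlyInverseˡ; strictlyInverseʳ)

  _≟_ : (x y : Carrier) → Dec (x ≡ y)
  x ≟ y with to x Data.Fin.≟ to y
  ... | yes p = yes (trans (sym (strictlyInverseʳ x)) (trans (cong from p) (strictlyInverseʳ y)))
  ... | no ¬p = no (λ e → ¬p (cong to e))

  *-cancelˡ : ∀ {x u v} → x ≢ 0# → x * u ≡ x * v → u ≡ v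
  *-cancelˡ {x} {u} {v} x≢0 xu≡xv with inverse x x≢0
  ... | x⁻¹ , xx⁻¹≡1 = begin
    u                 ≡⟨ sym (*-identityˡ u) ⟩
    1# * u            ≡⟨ cong (_* u) (trans (sym xx⁻¹≡1) (*-comm x x⁻¹)) ⟩
    (x⁻¹ * x) * u     ≡⟨ *-assoc x⁻¹ x u ⟩
    x⁻¹ * (x * u)     ≡⟨ cong (x⁻¹ *_) xu≡xv ⟩
    x⁻¹ * (x * v)     ≡⟨ sym (*-assoc x⁻¹ x v) ⟩
    (x⁻¹ * x) * v     ≡⟨ cong (_* v) (trans (*-comm x⁻¹ x) xx⁻¹≡1) ⟩
    1# * v            ≡⟨ *-identityˡ v ⟩
    v                 ∎

  *-nonzero : ∀ {x y} → x ≢ 0# → y ≢ 0# → x * y ≢ 0#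
  *-nonzero x≢0 y≢0 xy≡0 = y≢0 (*-cancelˡ x≢0 (trans xy≡0 (sym (zeroʳ _))))

  pow≡^ᶠ : ∀ x k → pow x k ≡ x ^ᶠ k
  pow≡^ᶠ x zero    = refl
  pow≡^ᶠ x (suc k) = cong (x *_) (pow≡^ᶠ x k)

  pow-+ : ∀ x k l → pow x (k + l) ≡ pow x k * pow x l
  pow-+ x k l = trans (pow≡^ᶠ x (k + l)) (trans (^-homo-* x k l) (sym (cong₂ _*_ (pow≡^ᶠ x k) (pow≡^ᶠ x l))))

  pow-* : ∀ x k l → pow (pow x k) l ≡ pow x (k ℕ.* l)
  pow-* x k l = begin
    pow (pow x k) l    ≡⟨ pow≡^ᶠ (pow x k) l ⟩
    pow x k ^ᶠ l       ≡⟨ cong (_^ᶠ l) (pow≡^ᶠ x k) ⟩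
    (x ^ᶠ k) ^ᶠ l      ≡⟨ ^-assocʳ x k l ⟩
    x ^ᶠ (k ℕ.* l)     ≡⟨ sym (pow≡^ᶠ x (k ℕ.* l)) ⟩
    pow x (k ℕ.* l)    ∎

  pow-distrib-* : ∀ x y k → pow (x * y) k ≡ pow x k * pow y k
  pow-distrib-* x y k = trans (pow≡^ᶠ (x * y) k) (trans (^-distrib-* x y k) (sym (cong₂ _*_ (pow≡^ᶠ x k) (pow≡^ᶠ y k))))

  pow-1# : ∀ k → pow 1# k ≡ 1#
  pow-1# zero    = refl
  pow-1# (suc k) = trans (*-identityˡ (pow 1# k)) (pow-1# k)

  pow≡0⇒≡0 : ∀ {x} k → pow x k ≡ 0# → x ≡ 0#
  pow≡0⇒≡0 zero 1≡0 = ⊥-elim (1≢0 1≡0)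
  pow≡0⇒≡0 {x} (suc k) xxᵏ≡0 with x ≟ 0#
  ... | yes x≡0 = x≡0
  ... | no x≢0  = pow≡0⇒≡0 k (*-cancelˡ x≢0 (trans xxᵏ≡0 (sym (zeroʳ x))))

  idempotent⇒0∨1 : ∀ {x} → x * x ≡ x → x ≡ 0# ⊎ x ≡ 1#
  idempotent⇒0∨1 {x} xx≡x with x ≟ 0#
  ... | yes x≡0 = inj₁ x≡0
  ... | no x≢0  = inj₂ (*-cancelˡ x≢0 (trans xx≡x (sym (*-identityʳ x))))

  ∃≢0≢1 : 2 < n → ∃ λ y → y ≢ 0# × y ≢ 1#
  ∃≢0≢1 2<n with fresh 2<n (to 0#) (to 1#)
  ... | k , k≢0 , k≢1 = from k , (λ e → k≢0 (to-from e)) , (λ e → k≢1 (to-from e))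
    where
    to-from : ∀ {k y} → from k ≡ y → k ≡ to y
    to-from {k} e = trans (sym (strictlyInverseˡ k)) (cong to e)

  +-translation : Carrier → Carrier ↔ Carrier
  +-translation a = mk↔ₛ′ (a ⊕_) (- a ⊕_) (cancel a (- a) (-‿inverseʳ a)) (cancel (- a) a (-‿inverseˡ a))
    where
    cancel : ∀ u v → u ⊕ v ≡ 0# → ∀ y → u ⊕ (v ⊕ y) ≡ y
    cancel u v uv≡0 y = trans (sym (+-assoc u v y)) (trans (cong (_⊕ y) uv≡0) (+-identityˡ y))

  *-dilation : ∀ a → a ≢ 0# → Carrier ↔ Carrier
  *-dilation a a≢0 with inverse a a≢0
  ... | a⁻¹ , aa⁻¹≡1 = mk↔ₛ′ (a *_) (a⁻¹ *_) (cancel a a⁻¹ aa⁻¹≡1) (cancel a⁻¹ a (trans (*-comm a⁻¹ a) aa⁻¹≡1))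
    where
    cancel : ∀ u v → u * v ≡ 1# → ∀ y → u * (v * y) ≡ y
    cancel u v uv≡1 y = trans (sym (*-assoc u v y)) (trans (cong (_* y) uv≡1) (*-identityˡ y))

  module ∑ = IndexedSum card +-commutativeMonoid
  module ∏ = IndexedSum card *-commutativeMonoid
  open ∑ using (∑)
  open ∏ using () renaming (∑ to ∏)
  open import Algebra.Properties.CommutativeMonoid.Sum +-commutativeMonoid
    using (∑-distrib-+; sum-replicate)
  open import Algebra.Properties.CommutativeMonoid.Mult +-commutativeMonoid
    using () renaming (_×_ to _·_) public
  import Algebra.Properties.CommutativeMonoid.Sum *-commutativeMonoid as *-Sum

  card·1≡0 : n · 1# ≡ 0#
  card·1≡0 = +-identityˡ-unique (n · 1#) (∑ (λ y → y)) (begin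
    n · 1# ⊕ ∑ (λ y → y)     ≡⟨ cong (_⊕ ∑ (λ y → y)) (sym (sum-replicate n)) ⟩
    ∑ (λ _ → 1#) ⊕ ∑ (λ y → y) ≡⟨ sym (∑-distrib-+ (λ _ → 1#) from) ⟩
    ∑ (1# ⊕_)                ≡⟨ sym (∑.∑-reindex (+-translation 1#) (λ y → y)) ⟩
    ∑ (λ y → y)              ∎)

  prod-nonzero : ∀ {k} (f : Fin k → Carrier) → (∀ i → f i ≢ 0#) → *-Sum.sum f ≢ 0#
  prod-nonzero {zero}  f f≢0 = 1≢0
  prod-nonzero {suc k} f f≢0 = *-nonzero (f≢0 zero) (prod-nonzero (f ∘ suc) (f≢0 ∘ suc))

  ∏-scale : ∀ a f → ∏ (λ y → a * f y) ≡ pow a n * ∏ f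
  ∏-scale a f = begin
    ∏ (λ y → a * f y)                ≡⟨ *-Sum.∑-distrib-+ {n} (λ _ → a) (f ∘ from) ⟩
    *-Sum.sum {n} (λ _ → a) * ∏ f     ≡⟨ cong (_* ∏ f) (trans (*-Sum.sum-replicate n) (sym (pow≡^ᶠ a n))) ⟩
    pow a n * ∏ f                    ∎

  zeroToOne : Carrier → Carrier
  zeroToOne y with y ≟ 0#
  ... | yes _ = 1#
  ... | no _  = y

  zeroToOne-≢0 : ∀ {y} → y ≢ 0# → zeroToOne y ≡ y
  zeroToOne-≢0 {y} y≢0 with y ≟ 0#
  ... | yes y≡0 = ⊥-elim (y≢0 y≡0)
  ... | no _    = refl

  zeroToOne-nonzero : ∀ y → zeroToOne y ≢ 0#
  zeroToOne-nonzero y with y ≟ 0#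
  ... | yes _   = 1≢0
  ... | no y≢0  = y≢0

  pow-0# : ∀ {k} → Fin k → pow 0# k ≡ 0#
  pow-0# {suc k} _ = zeroˡ (pow 0# k)

  -- y ↦ x y permutes the field and fixes only 0, where zeroToOne keeps the product invertible.
  fermat : ∀ x → pow x n ≡ x
  fermat x with x ≟ 0#
  ... | yes refl = pow-0# (to 0#)
  ... | no x≢0   = *-cancelˡ P≢0 (trans (*-comm P (pow x n)) (trans xⁿP≡xP (*-comm x P)))
    where
    P : Carrier
    P = ∏ zeroToOne
    P≢0 : P ≢ 0#
    P≢0 = prod-nonzero (zeroToOne ∘ from) (zeroToOne-nonzero ∘ from)
    xⁿP≡xP : pow x n * P ≡ x * P
    xⁿP≡xP = begin
      pow x n * P                        ≡⟨ sym (∏-scale x zeroToOne) ⟩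
      ∏ (λ y → x * zeroToOne y)          ≡⟨ ∏.∑-update (λ y → x * zeroToOne y) (zeroToOne ∘ (x *_)) 0# x
                                              (cong (λ z → x * zeroToOne z) (sym (zeroʳ x)))
                                              (λ y y≢0 → trans (cong (x *_) (zeroToOne-≢0 y≢0))
                                                                (sym (zeroToOne-≢0 (*-nonzero x≢0 y≢0)))) ⟩
      x * ∏ (zeroToOne ∘ (x *_))         ≡⟨ cong (x *_) (sym (∏.∑-reindex (*-dilation x x≢0) zeroToOne)) ⟩
      x * P                              ∎

module BinaryFieldProperties {c} (m : ℕ) (F : FiniteField c (2 ^ m)) where
  open FiniteField F renaming (_+_ to _⊕_)
  open FiniteFieldProperties F
  open import Algebra.Structures using (IsCommutativeRing)
  open IsCommutativeRing isCommutativeRing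
    using (+-assoc; +-comm; +-identityˡ; +-identityʳ; *-comm; *-identityʳ; distribˡ; distribʳ; zeroˡ; zeroʳ)
  open CommutativeRing ring using (semiring; +-commutativeMonoid)
  open import Algebra.Properties.Ring (CommutativeRing.ring ring) using (+-identityˡ-unique; +-cancelʳ)
  open import Algebra.Properties.Semiring.Mult semiring using (×1-homo-*)
  open import Algebra.Properties.CommutativeMonoid.Mult +-commutativeMonoid using (×-homo-+)
  import Algebra.Solver.CommutativeMonoid +-commutativeMonoid as +-Solver
  open +-Solver using (_⊜_) renaming (_⊕_ to _⊕'_)
  open ≡-Reasoning

  ^·1≡pow : ∀ k l → (k ^ l) · 1# ≡ pow (k · 1#) l
  ^·1≡pow k zero    = +-identityʳ 1#
  ^·1≡pow k (suc l) = trans (×1-homo-* k (k ^ l)) (cong ((k · 1#) *_) (^·1≡pow k l))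

  1+1≡0 : 1# ⊕ 1# ≡ 0#
  1+1≡0 = trans (cong (1# ⊕_) (sym (+-identityʳ 1#))) (pow≡0⇒≡0 m (trans (sym (^·1≡pow 2 m)) card·1≡0))

  x+x≡0 : ∀ x → x ⊕ x ≡ 0#
  x+x≡0 x = begin
    x ⊕ x              ≡⟨ sym (cong₂ _⊕_ (*-identityʳ x) (*-identityʳ x)) ⟩
    x * 1# ⊕ x * 1#    ≡⟨ sym (distribˡ x 1# 1#) ⟩
    x * (1# ⊕ 1#)      ≡⟨ cong (x *_) 1+1≡0 ⟩
    x * 0#             ≡⟨ zeroʳ x ⟩
    0#                 ∎

  odd·x≡x : ∀ j x → (j + suc j) · x ≡ x
  odd·x≡x j x = begin
    (j + suc j) · x        ≡⟨ ×-homo-+ x j (suc j) ⟩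
    j · x ⊕ (x ⊕ j · x)    ≡⟨ +-Solver.solve 2 (λ a b → a ⊕' (b ⊕' a) ⊜ b ⊕' (a ⊕' a)) refl (j · x) x ⟩
    x ⊕ (j · x ⊕ j · x)    ≡⟨ cong (x ⊕_) (x+x≡0 (j · x)) ⟩
    x ⊕ 0#                 ≡⟨ +-identityʳ x ⟩
    x                      ∎

  frob : ℕ → Carrier → Carrier
  frob j x = pow x (2 ^ j)

  frob-∘ : ∀ i j x → frob i (frob j x) ≡ frob (j + i) x
  frob-∘ i j x = trans (pow-* x (2 ^ j) (2 ^ i)) (cong (pow x) (sym (ℕ.^-distribˡ-+-* 2 j i)))

  frob-* : ∀ j x y → frob j (x * y) ≡ frob j x * frob j y
  frob-* j x y = pow-distrib-* x y (2 ^ j)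

  frob-suc : ∀ j x → frob (suc j) x ≡ frob j x * frob j x
  frob-suc j x = trans (pow-+ x (2 ^ j) (2 ^ j + 0)) (cong (λ e → frob j x * pow x e) (ℕ.+-identityʳ (2 ^ j)))

  frob-m : ∀ x → frob m x ≡ x
  frob-m = fermat

  Additive : (Carrier → Carrier) → Set c
  Additive g = ∀ x y → g (x ⊕ y) ≡ g x ⊕ g y

  additive-0 : ∀ {g} → Additive g → g 0# ≡ 0#
  additive-0 {g} g-+ = +-identityˡ-unique (g 0#) (g 0#) (trans (sym (g-+ 0# 0#)) (cong g (+-identityʳ 0#)))

  square-additive : Additive (λ x → x * x)
  square-additive x y = begin
    (x ⊕ y) * (x ⊕ y)                     ≡⟨ distribʳ (x ⊕ y) x y ⟩
    x * (x ⊕ y) ⊕ y * (x ⊕ y)             ≡⟨ cong₂ _⊕_ (distribˡ x x y) (distribˡ y x y) ⟩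
    (x * x ⊕ x * y) ⊕ (y * x ⊕ y * y)     ≡⟨ cong (λ z → (x * x ⊕ x * y) ⊕ (z ⊕ y * y)) (*-comm y x) ⟩
    (x * x ⊕ x * y) ⊕ (x * y ⊕ y * y)     ≡⟨ +-Solver.solve 3 (λ a b c → (a ⊕' b) ⊕' (b ⊕' c) ⊜ (a ⊕' c) ⊕' (b ⊕' b))
                                               refl (x * x) (x * y) (y * y) ⟩
    (x * x ⊕ y * y) ⊕ (x * y ⊕ x * y)     ≡⟨ cong ((x * x ⊕ y * y) ⊕_) (x+x≡0 (x * y)) ⟩
    (x * x ⊕ y * y) ⊕ 0#                  ≡⟨ +-identityʳ _ ⟩
    x * x ⊕ y * y                         ∎

  frob-additive : ∀ j → Additive (frob j)
  frob-additive zero    x y = distribʳ 1# x y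
  frob-additive (suc j) x y = begin
    frob (suc j) (x ⊕ y)                            ≡⟨ frob-suc j (x ⊕ y) ⟩
    frob j (x ⊕ y) * frob j (x ⊕ y)                 ≡⟨ cong (λ z → z * z) (frob-additive j x y) ⟩
    (frob j x ⊕ frob j y) * (frob j x ⊕ frob j y)   ≡⟨ square-additive (frob j x) (frob j y) ⟩
    frob j x * frob j x ⊕ frob j y * frob j y       ≡⟨ sym (cong₂ _⊕_ (frob-suc j x) (frob-suc j y)) ⟩
    frob (suc j) x ⊕ frob (suc j) y                 ∎

  sumTo-cong : ∀ k {f g : ℕ → Carrier} → (∀ i → f i ≡ g i) → sumTo k f ≡ sumTo k g
  sumTo-cong zero    f≗g = refl
  sumTo-cong (suc k) f≗g = cong₂ _⊕_ (sumTo-cong k f≗g) (f≗g k)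

  sumTo-+ : ∀ k f g → sumTo k (λ i → f i ⊕ g i) ≡ sumTo k f ⊕ sumTo k g
  sumTo-+ zero    f g = sym (+-identityˡ 0#)
  sumTo-+ (suc k) f g = trans (cong (_⊕ (f k ⊕ g k)) (sumTo-+ k f g))
    (+-Solver.solve 4 (λ a b c d → (a ⊕' b) ⊕' (c ⊕' d) ⊜ (a ⊕' c) ⊕' (b ⊕' d)) refl (sumTo k f) (sumTo k g) (f k) (g k))

  sumTo-const : ∀ k x → sumTo k (λ _ → x) ≡ k · x
  sumTo-const zero    x = refl
  sumTo-const (suc k) x = trans (cong (_⊕ x) (sumTo-const k x)) (+-comm (k · x) x)

  sumTo-shift : ∀ k f → sumTo k (f ∘ suc) ⊕ f 0 ≡ sumTo k f ⊕ f k
  sumTo-shift zero    f = refl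
  sumTo-shift (suc k) f = trans
    (+-Solver.solve 3 (λ a b c → (a ⊕' b) ⊕' c ⊜ (a ⊕' c) ⊕' b) refl (sumTo k (f ∘ suc)) (f (suc k)) (f 0))
    (cong (_⊕ f (suc k)) (sumTo-shift k f))

  additive-sumTo : ∀ {g} → Additive g → ∀ k f → g (sumTo k f) ≡ sumTo k (g ∘ f)
  additive-sumTo g-+ zero    f = additive-0 g-+
  additive-sumTo g-+ (suc k) f = trans (g-+ (sumTo k f) (f k)) (cong (_⊕ _) (additive-sumTo g-+ k f))

  Tr-additive : Additive (Tr m)
  Tr-additive x y = trans (sumTo-cong m (λ i → frob-additive i x y)) (sumTo-+ m (λ i → frob i x) (λ i → frob i y))

  Tr-frob1 : ∀ x → Tr m (frob 1 x) ≡ Tr m x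
  Tr-frob1 x = +-cancelʳ (frob 0 x) _ _ (begin
    Tr m (frob 1 x) ⊕ frob 0 x                  ≡⟨ cong (_⊕ frob 0 x) (sumTo-cong m (λ i → frob-∘ i 1 x)) ⟩
    sumTo m (λ i → frob (suc i) x) ⊕ frob 0 x   ≡⟨ sumTo-shift m (λ i → frob i x) ⟩
    Tr m x ⊕ frob m x                           ≡⟨ cong (Tr m x ⊕_) (trans (frob-m x) (sym (*-identityʳ x))) ⟩
    Tr m x ⊕ frob 0 x                           ∎)

  frob-suc′ : ∀ j x → frob (suc j) x ≡ frob 1 (frob j x)
  frob-suc′ j x = sym (trans (frob-∘ 1 j x) (cong (λ k → frob k x) (ℕ.+-comm j 1)))

  Tr-frob : ∀ j x → Tr m (frob j x) ≡ Tr m x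
  Tr-frob zero    x = cong (Tr m) (*-identityʳ x)
  Tr-frob (suc j) x = trans (cong (Tr m) (frob-suc′ j x)) (trans (Tr-frob1 (frob j x)) (Tr-frob j x))

  Tr-idempotent : ∀ x → Tr m x * Tr m x ≡ Tr m x
  Tr-idempotent x = begin
    Tr m x * Tr m x                          ≡⟨ cong (Tr m x *_) (sym (*-identityʳ (Tr m x))) ⟩
    frob 1 (Tr m x)                          ≡⟨ additive-sumTo (frob-additive 1) m (λ i → frob i x) ⟩
    sumTo m (λ i → frob 1 (frob i x))        ≡⟨ sumTo-cong m (λ i → trans (sym (frob-suc′ i x)) (sym (frob-∘ i 1 x))) ⟩
    Tr m (frob 1 x)                          ≡⟨ Tr-frob1 x ⟩
    Tr m x                                   ∎

  Tr-0∨1 : ∀ x → Tr m x ≡ 0# ⊎ Tr m x ≡ 1#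
  Tr-0∨1 x = idempotent⇒0∨1 (Tr-idempotent x)

  Tr-1#-odd : ∀ j → m ≡ j + suc j → Tr m 1# ≡ 1#
  Tr-1#-odd j m-odd = begin
    Tr m 1#                 ≡⟨ sumTo-cong m (λ i → pow-1# (2 ^ i)) ⟩
    sumTo m (λ _ → 1#)      ≡⟨ sumTo-const m 1# ⟩
    m · 1#                  ≡⟨ cong (_· 1#) m-odd ⟩
    (j + suc j) · 1#        ≡⟨ odd·x≡x j 1# ⟩
    1#                      ∎

  x+y≡0⇒x≡y : ∀ {x y} → x ⊕ y ≡ 0# → x ≡ y
  x+y≡0⇒x≡y {x} {y} x+y≡0 = begin
    x                 ≡⟨ sym (+-identityʳ x) ⟩
    x ⊕ 0#            ≡⟨ cong (x ⊕_) (sym (x+x≡0 y)) ⟩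
    x ⊕ (y ⊕ y)       ≡⟨ sym (+-assoc x y y) ⟩
    (x ⊕ y) ⊕ y       ≡⟨ cong (_⊕ y) x+y≡0 ⟩
    0# ⊕ y            ≡⟨ +-identityˡ y ⟩
    y                 ∎

  frob1+id-nonzero : ∀ {y} → y ≢ 0# → y ≢ 1# → frob 1 y ⊕ y ≢ 0#
  frob1+id-nonzero {y} y≢0 y≢1 = subst (_≢ 0#) (sym factor) (*-nonzero y≢0 (y≢1 ∘ x+y≡0⇒x≡y))
    where
    factor : frob 1 y ⊕ y ≡ y * (y ⊕ 1#)
    factor = trans (cong₂ _⊕_ (cong (y *_) (*-identityʳ y)) (sym (*-identityʳ y))) (sym (distribˡ y y 1#))

  expand-product : ∀ a b p q x y →
    (a ⊕ b) * (p ⊕ q) ⊕ (x ⊕ y) ≡ ((a * p ⊕ x) ⊕ (b * q ⊕ y)) ⊕ (a * q ⊕ b * p)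
  expand-product a b p q x y = begin
    (a ⊕ b) * (p ⊕ q) ⊕ (x ⊕ y)                     ≡⟨ cong (_⊕ (x ⊕ y)) (distribʳ (p ⊕ q) a b) ⟩
    (a * (p ⊕ q) ⊕ b * (p ⊕ q)) ⊕ (x ⊕ y)           ≡⟨ cong (_⊕ (x ⊕ y)) (cong₂ _⊕_ (distribˡ a p q) (distribˡ b p q)) ⟩
    ((a * p ⊕ a * q) ⊕ (b * p ⊕ b * q)) ⊕ (x ⊕ y)   ≡⟨ +-Solver.solve 6 (λ ap aq bp bq x y →
                                                          ((ap ⊕' aq) ⊕' (bp ⊕' bq)) ⊕' (x ⊕' y) ⊜ ((ap ⊕' x) ⊕' (bq ⊕' y)) ⊕' (aq ⊕' bp))
                                                          refl (a * p) (a * q) (b * p) (b * q) x y ⟩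
    ((a * p ⊕ x) ⊕ (b * q ⊕ y)) ⊕ (a * q ⊕ b * p)   ∎

  module OddDegree (j : ℕ) (m-odd : m ≡ j + suc j) where

    Q : Carrier → Carrier
    Q x = frob (suc j) x * frob 1 x ⊕ x

    φ : Carrier → Carrier
    φ x = Tr m (Q x)

    Tr-transpose : ∀ x y → Tr m (frob (suc j) y * frob 1 x) ≡ Tr m (y * frob (suc j) x)
    Tr-transpose x y = begin
      Tr m (frob (suc j) y * frob 1 x)                     ≡⟨ sym (Tr-frob j _) ⟩
      Tr m (frob j (frob (suc j) y * frob 1 x))            ≡⟨ cong (Tr m) (frob-* j _ _) ⟩
      Tr m (frob j (frob (suc j) y) * frob j (frob 1 x))   ≡⟨ cong (Tr m) (cong₂ _*_ (frob-∘ j (suc j) y) (frob-∘ j 1 x)) ⟩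
      Tr m (frob (suc j + j) y * frob (suc j) x)           ≡⟨ cong (λ k → Tr m (frob k y * frob (suc j) x)) suc-j+j≡m ⟩
      Tr m (frob m y * frob (suc j) x)                     ≡⟨ cong (λ z → Tr m (z * frob (suc j) x)) (frob-m y) ⟩
      Tr m (y * frob (suc j) x)                            ∎
      where
      suc-j+j≡m : suc j + j ≡ m
      suc-j+j≡m = trans (sym (ℕ.+-suc j j)) (sym m-odd)

    φ-polar : ∀ x y → φ (x ⊕ y) ≡ (φ x ⊕ φ y) ⊕ Tr m (frob (suc j) x * (frob 1 y ⊕ y))
    φ-polar x y = begin
      φ (x ⊕ y)
        ≡⟨ cong (Tr m) (trans (cong₂ (λ u v → u * v ⊕ (x ⊕ y)) (frob-additive (suc j) x y) (frob-additive 1 x y))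
                              (expand-product a b p q x y)) ⟩
      Tr m ((Q x ⊕ Q y) ⊕ (a * q ⊕ b * p))
        ≡⟨ trans (Tr-additive _ _) (cong₂ _⊕_ (Tr-additive (Q x) (Q y)) (Tr-additive (a * q) (b * p))) ⟩
      (φ x ⊕ φ y) ⊕ (Tr m (a * q) ⊕ Tr m (b * p))
        ≡⟨ cong (λ z → (φ x ⊕ φ y) ⊕ (Tr m (a * q) ⊕ z)) (trans (Tr-transpose x y) (cong (Tr m) (*-comm y a))) ⟩
      (φ x ⊕ φ y) ⊕ (Tr m (a * q) ⊕ Tr m (a * y))
        ≡⟨ cong ((φ x ⊕ φ y) ⊕_) (trans (sym (Tr-additive (a * q) (a * y))) (cong (Tr m) (sym (distribˡ a q y)))) ⟩
      (φ x ⊕ φ y) ⊕ Tr m (a * (q ⊕ y))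
        ∎
      where
      a b p q : Carrier
      a = frob (suc j) x
      b = frob (suc j) y
      p = frob 1 x
      q = frob 1 y

    φ-0 : φ 0# ≡ 0#
    φ-0 = begin
      Tr m (frob (suc j) 0# * frob 1 0# ⊕ 0#)   ≡⟨ cong (λ z → Tr m (z * frob 1 0# ⊕ 0#)) (additive-0 (frob-additive (suc j))) ⟩
      Tr m (0# * frob 1 0# ⊕ 0#)                ≡⟨ cong (λ z → Tr m (z ⊕ 0#)) (zeroˡ (frob 1 0#)) ⟩
      Tr m (0# ⊕ 0#)                            ≡⟨ cong (Tr m) (+-identityʳ 0#) ⟩
      Tr m 0#                                   ≡⟨ additive-0 Tr-additive ⟩
      0#                                        ∎

    ∃φ≡1 : 2 < 2 ^ m → ∃ λ x → φ x ≡ 1#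
    ∃φ≡1 2<q with ∃≢0≢1 2<q
    ... | y , y≢0 , y≢1 with inverse (frob 1 y ⊕ y) (frob1+id-nonzero y≢0 y≢1)
    ... | w⁻¹ , ww⁻¹≡1 = pick (Tr-0∨1 (Q x)) (Tr-0∨1 (Q y))
      where
      x : Carrier
      x = frob j w⁻¹
      cross≡1 : Tr m (frob (suc j) x * (frob 1 y ⊕ y)) ≡ 1#
      cross≡1 = begin
        Tr m (frob (suc j) x * (frob 1 y ⊕ y))   ≡⟨ cong (λ z → Tr m (z * (frob 1 y ⊕ y))) (frob-∘ (suc j) j w⁻¹) ⟩
        Tr m (frob (j + suc j) w⁻¹ * (frob 1 y ⊕ y))
                                                 ≡⟨ cong (λ k → Tr m (frob k w⁻¹ * (frob 1 y ⊕ y))) (sym m-odd) ⟩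
        Tr m (frob m w⁻¹ * (frob 1 y ⊕ y))       ≡⟨ cong (λ z → Tr m (z * (frob 1 y ⊕ y))) (frob-m w⁻¹) ⟩
        Tr m (w⁻¹ * (frob 1 y ⊕ y))              ≡⟨ cong (Tr m) (trans (*-comm w⁻¹ _) ww⁻¹≡1) ⟩
        Tr m 1#                                  ≡⟨ Tr-1#-odd j m-odd ⟩
        1#                                       ∎
      pick : (φ x ≡ 0# ⊎ φ x ≡ 1#) → (φ y ≡ 0# ⊎ φ y ≡ 1#) → ∃ λ z → φ z ≡ 1#
      pick (inj₂ φx≡1) _           = x , φx≡1
      pick (inj₁ _)    (inj₂ φy≡1) = y , φy≡1
      pick (inj₁ φx≡0) (inj₁ φy≡0) = x ⊕ y , (begin
        φ (x ⊕ y)                ≡⟨ φ-polar x y ⟩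
        (φ x ⊕ φ y) ⊕ Tr m (frob (suc j) x * (frob 1 y ⊕ y))
                                 ≡⟨ cong (_⊕ Tr m (frob (suc j) x * (frob 1 y ⊕ y))) (cong₂ _⊕_ φx≡0 φy≡0) ⟩
        (0# ⊕ 0#) ⊕ Tr m (frob (suc j) x * (frob 1 y ⊕ y))
                                 ≡⟨ cong₂ _⊕_ (+-identityʳ 0#) cross≡1 ⟩
        0# ⊕ 1#                  ≡⟨ +-identityˡ 1# ⟩
        1#                       ∎)

    pow-τ+2 : ∀ x → pow x (2 ^ suc j + 2) ≡ frob (suc j) x * frob 1 x
    pow-τ+2 x = pow-+ x (2 ^ suc j) 2

    Tr[Q+1]≡0 : ∀ {x} → φ x ≡ 1# → Tr m (Q x ⊕ 1#) ≡ 0#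
    Tr[Q+1]≡0 {x} φx≡1 = begin
      Tr m (Q x ⊕ 1#)      ≡⟨ Tr-additive (Q x) 1# ⟩
      φ x ⊕ Tr m 1#        ≡⟨ cong₂ _⊕_ φx≡1 (Tr-1#-odd j m-odd) ⟩
      1# ⊕ 1#              ≡⟨ 1+1≡0 ⟩
      0#                   ∎

    ∃-Tr≡0 : 2 < 2 ^ m → ∃ λ x → x ≢ 0# × Tr m ((pow x (2 ^ suc j + 2) ⊕ x) ⊕ 1#) ≡ 0#
    ∃-Tr≡0 2<q = x , x≢0 , trans (cong (λ z → Tr m ((z ⊕ x) ⊕ 1#)) (pow-τ+2 x)) (Tr[Q+1]≡0 φx≡1)
      where
      x : Carrier
      x = proj₁ (∃φ≡1 2<q)
      φx≡1 : φ x ≡ 1#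
      φx≡1 = proj₂ (∃φ≡1 2<q)
      x≢0 : x ≢ 0#
      x≢0 x≡0 = 1≢0 (trans (sym φx≡1) (trans (cong φ x≡0) φ-0))

lemma4p2 : ∀ {c : Level} (m : ℕ) → 1 < m → m % 2 ≡ 1 →
    (F : FiniteField c (2 ^ m)) →
    let open FiniteField F renaming (_+_ to _⊕_)
        τ = 2 ^ ((m + 1) / 2)
    in ∃ λ (x : Carrier) → (x ≢ 0#) × (Tr m ((pow x (τ + 2) ⊕ x) ⊕ 1#) ≡ 0#)
lemma4p2 m 1<m m-odd F =
  subst (λ k → ∃ λ x → x ≢ 0# × Tr m ((pow x (2 ^ k + 2) ⊕ x) ⊕ 1#) ≡ 0#)
        (sym (odd⇒[m+1]/2≡suc[m/2] m m-odd))
        (OddDegree.∃-Tr≡0 (m / 2) (odd⇒≡m/2+suc[m/2] m m-odd) 2<2^m)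
  where
  open FiniteField F renaming (_+_ to _⊕_)
  open BinaryFieldProperties m F using (module OddDegree)
  2<2^m : 2 < 2 ^ m
  2<2^m = ℕ.≤-trans (ℕ.n≤1+n 3) (ℕ.^-monoʳ-≤ 2 1<m)
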